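{- $\mathrm{LOP}\notin \mathsf{MIN}^{dt}$; that is, the Linear Ordering Principle does not admit an efficient (complexity $\mathrm{polylog}$ in the input length) decision-tree reduction (formulation) to the Least Number problem.
   Context: A query search problem is a sequence $R=(R_n)$ of relations $R_n\subseteq\{0,1\}^n\times\mathcal{O}_n$; it is total if every $x$ has some $o$ with $(x,o)\in R_n$. $R\in\mathrm{TF}\Sigma_2^{dt}$ if it is total and for every $n$ and $o\in\mathcal{O}_n$ there are decision trees $V_{o,z}$ of depth $\mathrm{polylog}(n)$, one for each string $z$ of length $\mathrm{polylog}(n)$, with $R_n(x,o)$ iff $V_{o,z}(x)=1$ for all $z$. For total search problems $R\subseteq\{0,1\}^n\times\mathcal{O}_n$, $S\subseteq\{0,1\}^m\times\mathcal{O}'_m$, an $S$-formulation of $R$ consists of $f_i:\{0,1\}^n\to\{0,1\}$ ($i\in[m]$) and $g_o:\{0,1\}^n\to\mathcal{O}_n$ ($o\in\mathcal{O}'_m$) with $S(f(x),o)\Rightarrow R(x,g_o(x))$, $f(x)=(f_1(x),\dots,f_m(x))$; its complexity is $\log m$ plus the maximum decision-tree depth of the $f_i,g_o$. For sequences, $R\le_{dt}S$ if for each $n$ some $S_m$-formulation of $R_n$ has complexity $\mathrm{polylog}(n)$. Least Number ($\mathrm{Min}$): the input is $f:[2^n]\to\{0,1\}$ given by its $2^n$ bits; a solution is $\bot$ if $f(x)=0$ for all $x$, or an $x$ with $f(x)=1$ and $f(y)=0$ for all $y<x$. $\mathsf{MIN}^{dt}$ is the class of problems $Q\in\mathrm{TF}\Sigma_2^{dt}$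 with $Q\le_{dt}\mathrm{Min}$. Linear Ordering Principle ($\mathrm{LOP}$): input a relation $\prec$ on $[N]$ given by bits $x_{i,j}$ ($x_{i,j}=1$ iff $i\prec j$); a solution is either an element $a$ with $a\prec b$ for all $b\neq a$, or distinct $a,b,c$ with $a\prec a$, or ($a\not\prec b$ and $b\not\prec a$), or ($a\prec b$, $b\prec c$, $a\not\prec c$). -}

module Defs where

open import Data.Nat using (ℕ; zero; suc; _+_; _*_; _^_; _≤_; _⊔_)
open import Data.Nat.Logarithm using (⌈log₂_⌉)
open import Data.Bool using (Bool; true; false)
open import Data.Fin using (Fin) renaming (_<_ to _<ᶠ_)
open import Data.Maybe using (Maybe; just; nothing)
open import Data.Sum using (_⊎_)
open import Data.Product using (Σ; ∃; _×_; _,_; ∃-syntax)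
open import Relation.Binary.PropositionalEquality using (_≡_; _≢_)

data DT (I : Set) (A : Set) : Set where
  leaf : A → DT I A
  node : I → DT I A → DT I A → DT I A

eval : {I A : Set} → DT I A → (I → Bool) → A
eval (leaf a) x = a
eval (node i t₀ t₁) x with x i
... | false = eval t₀ x
... | true  = eval t₁ x

depth : {I A : Set} → DT I A → ℕ
depth (leaf _) = 0
depth (node _ t₀ t₁) = suc (depth t₀ ⊔ depth t₁)

-- The input of the n-th instance is a bit string indexed by the finite set
-- Bit n, which has  size n  elements (the input length).

record SearchProblem : Set₁ where
  field
    Bit  : ℕ → Set
    size : ℕ → ℕ
    Out  : ℕ → Set
    Sol  : (n : ℕ) → (Bit n → Bool) → Out n → Set

open SearchProblem public

record Formulation (R S : SearchProblem) (n m d : ℕ) : Set where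
  field
    f       : Bit S m → DT (Bit R n) Bool
    g       : Out S m → DT (Bit R n) (Out R n)
    f-depth : ∀ i → depth (f i) ≤ d
    g-depth : ∀ o → depth (g o) ≤ d
    sound   : ∀ (x : Bit R n → Bool) (o : Out S m) →
              Sol S m (λ i → eval (f i) x) o → Sol R n x (eval (g o) x)

formulationComplexity : (S : SearchProblem) (m d : ℕ) → ℕ
formulationComplexity S m d = ⌈log₂ size S m ⌉ + d

polylog : ℕ → ℕ → ℕ
polylog c L = (⌈log₂ L ⌉ + 2) ^ c

_≤dt_ : SearchProblem → SearchProblem → Set
R ≤dt S = ∃[ c ] ∀ (n : ℕ) → ∃[ m ] ∃[ d ]
  (Formulation R S n m d × formulationComplexity S m d ≤ polylog c (size R n))

-- Least Number: instance n has input f : [2^n] → {0,1};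
-- output nothing = ⊥, just a = a least element with f a = 1.

MinSol : (n : ℕ) → (Fin (2 ^ n) → Bool) → Maybe (Fin (2 ^ n)) → Set
MinSol n x nothing  = ∀ y → x y ≡ false
MinSol n x (just a) = x a ≡ true × (∀ y → y <ᶠ a → x y ≡ false)

Min : SearchProblem
Min = record
  { Bit  = λ n → Fin (2 ^ n)
  ; size = λ n → 2 ^ n
  ; Out  = λ n → Maybe (Fin (2 ^ n))
  ; Sol  = MinSol
  }

-- Linear Ordering Principle on the universe [N], with N = n + 1 for the
-- n-th instance; bit (i , j) is x_{i,j}, i.e. i ≺ j.

data LOPOut (N : ℕ) : Set where
  minimal      : Fin N → LOPOut N
  reflexive    : Fin N → LOPOut N
  incomparable : Fin N → Fin N → LOPOut N
  intransitive : Fin N → Fin N → Fin N → LOPOut N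

LOPSol : (N : ℕ) → (Fin N × Fin N → Bool) → LOPOut N → Set
LOPSol N x (minimal a) = ∀ b → b ≢ a → x (a , b) ≡ true
LOPSol N x (reflexive a) = x (a , a) ≡ true
LOPSol N x (incomparable a b) =
  a ≢ b × x (a , b) ≡ false × x (b , a) ≡ false
LOPSol N x (intransitive a b c) =
  (a ≢ b × b ≢ c × a ≢ c) ×
  x (a , b) ≡ true × x (b , c) ≡ true × x (a , c) ≡ false

LOP : SearchProblem
LOP = record
  { Bit  = λ n → Fin (suc n) × Fin (suc n)
  ; size = λ n → suc n * suc n
  ; Out  = λ n → LOPOut (suc n)
  ; Sol  = λ n → LOPSol (suc n)
  }

{-# OPTIONS --safe #-}
-- Adversary argument. Feed a depth-d formulation the linear orders of injective ranks
-- r : Fin (suc n) → ℕ, whose only LOP solution is the minimum. Given a Min solution o of the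
-- induced instance, the tree g o and (when o = just i) the tree f i computing bit i read at
-- most 4d elements, and g o names at most one more. If n > 4d, moving some other element e to
-- the bottom keeps bit i set and the answer of g o unchanged, although e is now the only LOP
-- solution; so every Min solution of the new instance lies strictly below o (⊥ counting as
-- 2 ^ m). This descent cannot go on forever, hence n ≤ 4d, and polylog depth violates this
-- for large n.
module Submission where

open import Defs
open import Data.Nat
open import Data.Nat.Properties
open import Data.Nat.Logarithm using (⌈log₂_⌉; ⌈log₂⌉-mono-≤; ⌈log₂2^n⌉≡n)
open import Data.Nat.Tactic.RingSolver using (solve-∀)
open import Data.Bool using (Bool; true; false; T) renaming (_≟_ to _≟ᵇ_)
open import Data.Bool.Properties using (¬-not; T-≡)
open import Data.Fin using (Fin; toℕ; fromℕ<; inject) renaming (_≟_ to _≟ᶠ_)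
open import Data.Fin.Properties using (¬∀⟶∃¬-smallest; ¬∀⟶∃¬; all?; injective⇒≤; toℕ-injective; toℕ<n; toℕ-inject; toℕ-fromℕ<)
open import Data.Maybe using (Maybe; just; nothing)
open import Data.List using (List; []; _∷_; _++_; length; lookup)
open import Data.List.Properties using (length-++)
open import Data.List.Membership.Propositional using (_∈_; _∉_)
open import Data.List.Membership.Propositional.Properties using (∈-++⁺ˡ; ∈-++⁺ʳ)
open import Data.List.Relation.Unary.Any using (here; there; index)
open import Data.List.Relation.Unary.Any.Properties using (lookup-index)
open import Data.Product using (∃; _×_; _,_; map)
open import Function using (_∘_; Injective; Equivalence)
open import Relation.Nullary using (¬_; yes; no; contradiction)
open import Relation.Binary.PropositionalEquality

module _ {I A : Set} where

  queries : DT I A → (I → Bool) → List I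
  queries (leaf _) x = []
  queries (node i t₀ t₁) x with x i
  ... | false = i ∷ queries t₀ x
  ... | true  = i ∷ queries t₁ x

  length-queries≤depth : ∀ t x → length (queries t x) ≤ depth t
  length-queries≤depth (leaf _) x = z≤n
  length-queries≤depth (node i t₀ t₁) x with x i
  ... | false = s≤s (≤-trans (length-queries≤depth t₀ x) (m≤m⊔n _ _))
  ... | true  = s≤s (≤-trans (length-queries≤depth t₁ x) (m≤n⊔m _ _))

  eval-cong-on-queries : ∀ t x y → (∀ i → i ∈ queries t x → x i ≡ y i) → eval t x ≡ eval t y
  eval-cong-on-queries (leaf _) x y agree = refl
  -- The first with re-types agree in normal form, where x i occurs, so the second with abstracts it there too.
  eval-cong-on-queries (node i t₀ t₁) x y agree with agree i
  ... | xi≡yi with x i | y i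
  ...   | false | false = eval-cong-on-queries t₀ x y (λ j → agree j ∘ there)
  ...   | true  | true  = eval-cong-on-queries t₁ x y (λ j → agree j ∘ there)
  ...   | false | true  with () ← xi≡yi (here refl)
  ...   | true  | false with () ← xi≡yi (here refl)

module _ {A : Set} where

  endpoints : List (A × A) → List A
  endpoints [] = []
  endpoints ((a , b) ∷ ps) = a ∷ b ∷ endpoints ps

  length-endpoints : ∀ ps → length (endpoints ps) ≡ length ps + length ps
  length-endpoints [] = refl
  length-endpoints ((a , b) ∷ ps) =
    cong suc (trans (cong suc (length-endpoints ps)) (sym (+-suc (length ps) (length ps))))

  ∈-endpoints : ∀ {a b ps} → (a , b) ∈ ps → a ∈ endpoints ps × b ∈ endpoints ps
  ∈-endpoints {ps = _ ∷ _} (here refl) = here refl , there (here refl)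
  ∈-endpoints {ps = _ ∷ _} (there p) with a∈ , b∈ ← ∈-endpoints p = there (there a∈) , there (there b∈)

length<⇒∃∉ : ∀ {N} (xs : List (Fin N)) → length xs < N → ∃ (_∉ xs)
length<⇒∃∉ {N} xs |xs|<N = ¬∀⟶∃¬ N (_∈ xs) (_∈? xs) λ every∈ →
  <⇒≱ |xs|<N (injective⇒≤ {f = index ∘ every∈} λ {e} {e′} same-index →
    trans (lookup-index (every∈ e)) (trans (cong (lookup xs) same-index) (sym (lookup-index (every∈ e′)))))
  where open import Data.List.Membership.DecPropositional (_≟ᶠ_ {N}) using (_∈?_)

<ᵇ≡true⇒< : ∀ m n → (m <ᵇ n) ≡ true → m < n
<ᵇ≡true⇒< m n = <ᵇ⇒< m n ∘ Equivalence.from T-≡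

<ᵇ≡false⇒≥ : ∀ m n → (m <ᵇ n) ≡ false → n ≤ m
<ᵇ≡false⇒≥ m n m≮ᵇn = ≮⇒≥ (subst T m≮ᵇn ∘ <⇒<ᵇ)

module _ {N : ℕ} where

  rankOrder : (Fin N → ℕ) → Fin N × Fin N → Bool
  rankOrder r (a , b) = r a <ᵇ r b

  rankOrder-solution≡minimal : ∀ {r e o} → Injective _≡_ _≡_ r → r e ≡ 0 →
                               LOPSol N (rankOrder r) o → o ≡ minimal e
  rankOrder-solution≡minimal {r} {e} {minimal a} r-inj re≡0 below-all with a ≟ᶠ e
  ... | yes refl = refl
  ... | no a≢e = contradiction (subst (r a <_) re≡0 (<ᵇ≡true⇒< (r a) (r e) (below-all e (a≢e ∘ sym)))) n≮0
  rankOrder-solution≡minimal {r} {o = reflexive a} _ _ a≺a =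
    contradiction (<ᵇ≡true⇒< (r a) (r a) a≺a) (<-irrefl refl)
  rankOrder-solution≡minimal {r} {o = incomparable a b} r-inj _ (a≢b , a⊀b , b⊀a) =
    contradiction (r-inj (≤-antisym (<ᵇ≡false⇒≥ (r b) (r a) b⊀a) (<ᵇ≡false⇒≥ (r a) (r b) a⊀b))) a≢b
  rankOrder-solution≡minimal {r} {o = intransitive a b c} _ _ (_ , a≺b , b≺c , a⊀c) =
    contradiction (<ᵇ≡false⇒≥ (r a) (r c) a⊀c)
      (<⇒≱ (<-trans (<ᵇ≡true⇒< (r a) (r b) a≺b) (<ᵇ≡true⇒< (r b) (r c) b≺c)))

  moveToBottom : Fin N → (Fin N → ℕ) → Fin N → ℕ
  moveToBottom e r c with c ≟ᶠ e
  ... | yes _ = 0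
  ... | no  _ = suc (r c)

  moveToBottom-≡0 : ∀ e r → moveToBottom e r e ≡ 0
  moveToBottom-≡0 e r with e ≟ᶠ e
  ... | yes _ = refl
  ... | no e≢e = contradiction refl e≢e

  moveToBottom-≢ : ∀ {e c} r → c ≢ e → moveToBottom e r c ≡ suc (r c)
  moveToBottom-≢ {e} {c} r c≢e with c ≟ᶠ e
  ... | yes c≡e = contradiction c≡e c≢e
  ... | no  _   = refl

  moveToBottom-injective : ∀ {e r} → Injective _≡_ _≡_ r → Injective _≡_ _≡_ (moveToBottom e r)
  moveToBottom-injective {e} {r} r-inj {a} {b} same with a ≟ᶠ e | b ≟ᶠ e
  ... | yes a≡e | yes b≡e = trans a≡e (sym b≡e)
  ... | no  _   | no  _   = r-inj (suc-injective same)
  moveToBottom-injective r-inj () | yes _ | no _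
  moveToBottom-injective r-inj () | no _  | yes _

  eval-moveToBottom : ∀ {A e r} (t : DT (Fin N × Fin N) A) → e ∉ endpoints (queries t (rankOrder r)) →
                      eval t (rankOrder (moveToBottom e r)) ≡ eval t (rankOrder r)
  eval-moveToBottom {e = e} {r} t e∉ = sym (eval-cong-on-queries t _ _ λ where
    (a , b) ab∈ → let a∈ , b∈ = ∈-endpoints ab∈ in
      sym (cong₂ _<ᵇ_ (moveToBottom-≢ r (≢e a∈)) (moveToBottom-≢ r (≢e b∈))))
    where
    ≢e : ∀ {a} → a ∈ endpoints (queries t (rankOrder r)) → a ≢ e
    ≢e a∈ refl = e∉ a∈

MinSol-total : ∀ n x → ∃ (MinSol n x)
MinSol-total n x with all? (λ i → x i ≟ᵇ false)
... | yes all-false = nothing , all-false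
... | no some-true with i , xi≢false , earlier-false ← ¬∀⟶∃¬-smallest _ _ (λ i → x i ≟ᵇ false) some-true =
  just i , ¬-not xi≢false , λ y y<i → subst (λ z → x z ≡ false) (inject-fromℕ< y<i) (earlier-false (fromℕ< y<i))
  where
  inject-fromℕ< : ∀ {K} {y i : Fin K} (y<i : toℕ y < toℕ i) → inject (fromℕ< y<i) ≡ y
  inject-fromℕ< y<i = toℕ-injective (trans (toℕ-inject (fromℕ< y<i)) (toℕ-fromℕ< y<i))

height : ∀ {K} → Maybe (Fin K) → ℕ
height {K} nothing = K
height (just i) = toℕ i

height≤ : ∀ {K} (o : Maybe (Fin K)) → height o ≤ K
height≤ nothing = ≤-refl
height≤ (just i) = <⇒≤ (toℕ<n i)

height-injective : ∀ {K} → Injective _≡_ _≡_ (height {K})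
height-injective {x = nothing} {nothing} _ = refl
height-injective {x = just i} {just j} same = cong just (toℕ-injective same)
height-injective {x = nothing} {just j} K≡j = contradiction (sym K≡j) (<⇒≢ (toℕ<n j))
height-injective {x = just i} {nothing} i≡K = contradiction i≡K (<⇒≢ (toℕ<n i))

MinSol-height≤ : ∀ {n x o i} → MinSol n x o → x i ≡ true → height o ≤ toℕ i
MinSol-height≤ {o = nothing} {i} all-false xi≡true = contradiction (trans (sym (all-false i)) xi≡true) λ ()
MinSol-height≤ {o = just a} {i} (_ , earlier-false) xi≡true =
  ≮⇒≥ λ i<a → contradiction (trans (sym (earlier-false i i<a)) xi≡true) λ ()

n<2^n : ∀ n → n < 2 ^ n
n<2^n zero    = z<s
n<2^n (suc n) = +-mono-≤ (m^n>0 2 n) (≤-trans (n<2^n n) (m≤m+n (2 ^ n) 0))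

linear≤exponential : ∀ a b → ∃ λ s → a * s + b ≤ 2 ^ s
linear≤exponential a b = t + t , (begin
  a * (t + t) + b                          ≤⟨ m≤m+n _ _ ⟩
  a * (t + t) + b + (b * (a + a + b) + t)  ≡⟨ expand a b ⟩
  t * t                                    ≤⟨ *-mono-≤ (<⇒≤ (n<2^n t)) (<⇒≤ (n<2^n t)) ⟩
  2 ^ t * 2 ^ t                            ≡⟨ ^-distribˡ-+-* 2 t t ⟨
  2 ^ (t + t)                              ∎)
  where
  open ≤-Reasoning
  t = a + a + b + 1
  expand : ∀ a b → let t = a + a + b + 1 in a * (t + t) + b + (b * (a + a + b) + t) ≡ t * t
  expand = solve-∀

exponential>polynomial : ∀ a c → ∃ λ k → a * (k + k + 4) ^ c < 2 ^ k
exponential>polynomial a c = map (2 ^_) (λ {s} → dominated s) (linear≤exponential c (a + 3 * c))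
  where
  dominated : ∀ s → c * s + (a + 3 * c) ≤ 2 ^ s → let k = 2 ^ s in a * (k + k + 4) ^ c < 2 ^ k
  dominated s linear = begin-strict
    a * (k + k + 4) ^ c          ≤⟨ *-monoʳ-≤ a (^-monoˡ-≤ c k+k+4≤2^[s+3]) ⟩
    a * (2 ^ (s + 3)) ^ c        ≡⟨ cong (a *_) (^-*-assoc 2 (s + 3) c) ⟩
    a * 2 ^ ((s + 3) * c)        <⟨ *-monoˡ-< (2 ^ ((s + 3) * c)) {{m^n≢0 2 ((s + 3) * c)}} (n<2^n a) ⟩
    2 ^ a * 2 ^ ((s + 3) * c)    ≡⟨ ^-distribˡ-+-* 2 a _ ⟨
    2 ^ (a + (s + 3) * c)        ≤⟨ ^-monoʳ-≤ 2 (≤-trans (≤-reflexive (rearrange a c s)) linear) ⟩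
    2 ^ k                        ∎
    where
    open ≤-Reasoning
    k = 2 ^ s
    k+k+4≤2^[s+3] : k + k + 4 ≤ 2 ^ (s + 3)
    k+k+4≤2^[s+3] = begin
      k + k + 4      ≤⟨ +-monoʳ-≤ (k + k) (≤-trans (m≤n+m 4 2) (*-monoˡ-≤ 6 (m^n>0 2 s))) ⟩
      k + k + k * 6  ≡⟨ eight k ⟩
      k * 8          ≡⟨ ^-distribˡ-+-* 2 s 3 ⟨
      2 ^ (s + 3)    ∎
      where
      eight : ∀ k → k + k + k * 6 ≡ k * 8
      eight = solve-∀
    rearrange : ∀ a c s → a + (s + 3) * c ≡ c * s + (a + 3 * c)
    rearrange = solve-∀

polylog-bound : ∀ c k → polylog c (suc (2 ^ k) * suc (2 ^ k)) ≤ (k + k + 4) ^ c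
polylog-bound c k = ^-monoˡ-≤ c (≤-trans (+-monoˡ-≤ 2 log-bound) (≤-reflexive (regroup k)))
  where
  1+2^k≤2^[1+k] : suc (2 ^ k) ≤ 2 ^ suc k
  1+2^k≤2^[1+k] = ^-monoʳ-< 2 (s≤s (s≤s z≤n)) (n<1+n k)
  log-bound : ⌈log₂ (suc (2 ^ k) * suc (2 ^ k)) ⌉ ≤ suc k + suc k
  log-bound = begin
    ⌈log₂ (suc (2 ^ k) * suc (2 ^ k)) ⌉  ≤⟨ ⌈log₂⌉-mono-≤ (*-mono-≤ 1+2^k≤2^[1+k] 1+2^k≤2^[1+k]) ⟩
    ⌈log₂ (2 ^ suc k * 2 ^ suc k) ⌉      ≡⟨ cong ⌈log₂_⌉ (^-distribˡ-+-* 2 (suc k) (suc k)) ⟨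
    ⌈log₂ (2 ^ (suc k + suc k)) ⌉        ≡⟨ ⌈log₂2^n⌉≡n (suc k + suc k) ⟩
    suc k + suc k                        ∎
    where open ≤-Reasoning
  regroup : ∀ k → suc k + suc k + 2 ≡ k + k + 4
  regroup = solve-∀

polylog-sublinear : ∀ c a → ∃ λ n → a * polylog c (suc n * suc n) < n
polylog-sublinear c a =
  map (2 ^_) (λ {k} → ≤-<-trans (*-monoʳ-≤ a (polylog-bound c k))) (exponential>polynomial a c)

claimedMinimum : ∀ {N} → LOPOut N → List (Fin N)
claimedMinimum (minimal a) = a ∷ []
claimedMinimum _ = []

length-claimedMinimum : ∀ {N} (out : LOPOut N) → length (claimedMinimum out) ≤ 1
length-claimedMinimum (minimal _) = ≤-refl
length-claimedMinimum (reflexive _) = z≤n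
length-claimedMinimum (incomparable _ _) = z≤n
length-claimedMinimum (intransitive _ _ _) = z≤n

module Adversary {n m d : ℕ} (F : Formulation LOP Min n m d) (4d<n : 4 * d < n) where
  open Formulation F

  Rank : Set
  Rank = Fin (suc n) → ℕ

  minInstance : Rank → Fin (2 ^ m) → Bool
  minInstance r i = eval (f i) (rankOrder r)

  witnessQueries : Rank → Maybe (Fin (2 ^ m)) → List (Fin (suc n) × Fin (suc n))
  witnessQueries r nothing = []
  witnessQueries r (just i) = queries (f i) (rankOrder r)

  sensitive : Rank → Maybe (Fin (2 ^ m)) → List (Fin (suc n))
  sensitive r o = claimedMinimum (eval (g o) (rankOrder r))
               ++ endpoints (queries (g o) (rankOrder r)) ++ endpoints (witnessQueries r o)

  length-witnessQueries : ∀ r o → length (witnessQueries r o) ≤ d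
  length-witnessQueries r nothing = z≤n
  length-witnessQueries r (just i) = ≤-trans (length-queries≤depth (f i) _) (f-depth i)

  length-sensitive : ∀ r o → length (sensitive r o) < suc n
  length-sensitive r o = s≤s (begin
    length (claimedMinimum out ++ endpoints gq ++ endpoints wq)
      ≡⟨ length-++ (claimedMinimum out) ⟩
    length (claimedMinimum out) + length (endpoints gq ++ endpoints wq)
      ≡⟨ cong (length (claimedMinimum out) +_) (length-++ (endpoints gq)) ⟩
    length (claimedMinimum out) + (length (endpoints gq) + length (endpoints wq))
      ≤⟨ +-mono-≤ (length-claimedMinimum out) (+-mono-≤ (doubled gq gq≤d) (doubled wq (length-witnessQueries r o))) ⟩
    1 + (d + d + (d + d))  ≡⟨ cong suc (quadruple d) ⟩
    suc (4 * d)            ≤⟨ 4d<n ⟩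
    n                      ∎)
    where
    open ≤-Reasoning
    quadruple : ∀ d → d + d + (d + d) ≡ 4 * d
    quadruple = solve-∀
    out = eval (g o) (rankOrder r)
    gq = queries (g o) (rankOrder r)
    wq = witnessQueries r o
    gq≤d : length gq ≤ d
    gq≤d = ≤-trans (length-queries≤depth (g o) _) (g-depth o)
    doubled : ∀ {B : Set} (ps : List (B × B)) → length ps ≤ d → length (endpoints ps) ≤ d + d
    doubled ps ps≤d = ≤-trans (≤-reflexive (length-endpoints ps)) (+-mono-≤ ps≤d ps≤d)

  witness-survives : ∀ {r e} o → MinSol m (minInstance r) o → e ∉ endpoints (witnessQueries r o) →
                     ∀ {o′} → MinSol m (minInstance (moveToBottom e r)) o′ → height o′ ≤ height o
  witness-survives nothing _ _ {o′} _ = height≤ o′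
  witness-survives (just i) (fi≡true , _) e∉ sol′ =
    MinSol-height≤ sol′ (trans (eval-moveToBottom (f i) e∉) fi≡true)

  solution-moves : ∀ {r e o o′} → Injective _≡_ _≡_ r →
                   e ∉ claimedMinimum (eval (g o) (rankOrder r)) → e ∉ endpoints (queries (g o) (rankOrder r)) →
                   MinSol m (minInstance (moveToBottom e r)) o′ → o′ ≢ o
  solution-moves {r} {e} {o} r-inj e∉claimed e∉read sol′ refl =
    e∉claimed (subst (λ out → e ∈ claimedMinimum out) (sym g-answers-e) (here refl))
    where
    g-answers-e : eval (g o) (rankOrder r) ≡ minimal e
    g-answers-e = trans (sym (eval-moveToBottom (g o) e∉read))
      (rankOrder-solution≡minimal (moveToBottom-injective r-inj) (moveToBottom-≡0 e r) (sound _ o sol′))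

  moveToBottom-descends : ∀ {r o e} → Injective _≡_ _≡_ r → MinSol m (minInstance r) o → e ∉ sensitive r o →
                          ∀ {o′} → MinSol m (minInstance (moveToBottom e r)) o′ → height o′ < height o
  moveToBottom-descends {r} {o} r-inj sol e∉ sol′ =
    ≤∧≢⇒< (witness-survives o sol (e∉ ∘ ∈-++⁺ʳ claimed ∘ ∈-++⁺ʳ read) sol′)
          (solution-moves r-inj (e∉ ∘ ∈-++⁺ˡ) (e∉ ∘ ∈-++⁺ʳ claimed ∘ ∈-++⁺ˡ) sol′ ∘ height-injective)
    where
    claimed = claimedMinimum (eval (g o) (rankOrder r))
    read = endpoints (queries (g o) (rankOrder r))

  descent : ∀ {r o} → Injective _≡_ _≡_ r → MinSol m (minInstance r) o →
            ∃ λ r′ → Injective _≡_ _≡_ r′ × (∀ {o′} → MinSol m (minInstance r′) o′ → height o′ < height o)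
  descent {r} {o} r-inj sol with e , e∉ ← length<⇒∃∉ (sensitive r o) (length-sensitive r o) =
    moveToBottom e r , moveToBottom-injective r-inj , moveToBottom-descends r-inj sol e∉

  no-solution-below : ∀ k {r o} → height o < k → Injective _≡_ _≡_ r → ¬ MinSol m (minInstance r) o
  no-solution-below (suc k) o<1+k r-inj sol with descent r-inj sol
  ... | r′ , r′-inj , descends with MinSol-total m (minInstance r′)
  ... | o′ , sol′ = no-solution-below k (<-≤-trans (descends sol′) (s≤s⁻¹ o<1+k)) r′-inj sol′

LOP-Min-formulation-depth : ∀ {n m d} → Formulation LOP Min n m d → n ≤ 4 * d
LOP-Min-formulation-depth {m = m} F = ≮⇒≥ λ 4d<n →
  let open Adversary F 4d<n
      o , sol = MinSol-total m (minInstance toℕ)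
  in no-solution-below (suc (2 ^ m)) (s≤s (height≤ o)) toℕ-injective sol

theorem1p2 : ¬ (LOP ≤dt Min)
theorem1p2 (c , reduce) = sublinear-violation (polylog-sublinear c 4)
  where
  n≤4P : ∀ n → n ≤ 4 * polylog c (suc n * suc n)
  n≤4P n with m , d , F , cost ← reduce n =
    ≤-trans (LOP-Min-formulation-depth F) (*-monoʳ-≤ 4 (≤-trans (m≤n+m d ⌈log₂ 2 ^ m ⌉) cost))
  sublinear-violation : ¬ ∃ λ n → 4 * polylog c (suc n * suc n) < n
  sublinear-violation (n , 4P<n) = <⇒≱ 4P<n (n≤4P n)
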